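{- Let $n\ge 4$, $N=\{1,\dots,n\}$, let $i_1,i_2\in N$ with $i_1\ne i_2$, and let $\hat N^c=N\setminus\{i_1,i_2\}$. Then the inequality $$x_{i_2i_1}+\sum_{j\in\hat N^c}\left(x_{i_1j}+x_{ji_2}\right)-x_{i_1i_2}-\sum_{j,j'\in\hat N^c:\ j\ne j'} x_{jj'}\ \le\ 2-\frac{(n-4)(n-5)}{2}$$ is a valid inequality for the weak order polytope $P^n_{WO}$.
   Context: Let $N=\{1,\dots,n\}$ and $A_N=\{(i,j): i,j\in N,\ i\ne j\}$. A weak order on $N$ is a binary relation $W\subseteq N\times N$ that is reflexive, transitive and total; $(i,j)\in W$ is read "$i$ is preferred over or tied with $j$". The characteristic vector of $W$ is $x^W\in\{0,1\}^{A_N}$ with $x^W_{ij}=1$ if $(i,j)\in W$ and $0$ otherwise. The weak order polytope $P^n_{WO}\subseteq\mathbb{R}^{A_N}$ is the convex hull of the characteristic vectors of all weak orders on $N$. An inequality $\pi x\le\pi_0$ is valid for $P$ if it holds for every $x\in P$.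
   Formalization: The points of the weak order polytope $P^n_{WO}$ have rational coordinates and are convex combinations of characteristic vectors with rational weights, rather than real ones. -}

module Defs where

open import Data.Nat using (ℕ)
open import Data.Fin using (Fin; zero; suc; _≟_)
open import Data.Bool using (Bool; true; false; if_then_else_; not; _∧_)
open import Data.Integer using (ℤ; +_) renaming (_-_ to _-ℤ_; _*_ to _*ℤ_)
open import Data.Rational using (ℚ; 0ℚ; 1ℚ; _+_; _-_; _*_; _≤_; _/_)
open import Data.List using (List; []; _∷_)
open import Data.List.Relation.Unary.All using (All)
open import Data.Product using (Σ; _×_; _,_; proj₁; proj₂)
open import Data.Sum using (_⊎_)
open import Relation.Nullary using (¬_)
open import Relation.Nullary.Decidable using (⌊_⌋)
open import Relation.Binary.PropositionalEquality using (_≡_)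

Rel₂ : ℕ → Set
Rel₂ n = Fin n → Fin n → Bool

record IsWeakOrder {n : ℕ} (W : Rel₂ n) : Set where
  field
    refl  : ∀ i → W i i ≡ true
    trans : ∀ i j k → W i j ≡ true → W j k ≡ true → W i k ≡ true
    total : ∀ i j → (W i j ≡ true) ⊎ (W j i ≡ true)

WeakOrder : ℕ → Set
WeakOrder n = Σ (Rel₂ n) IsWeakOrder

-- Points of ℚ^{A_N}: functions on pairs; diagonal entries are ignored everywhere.
Point : ℕ → Set
Point n = Fin n → Fin n → ℚ

charVec : ∀ {n} → WeakOrder n → Point n
charVec (W , _) i j = if W i j then 1ℚ else 0ℚ

combo : ∀ {n} → List (ℚ × WeakOrder n) → Fin n → Fin n → ℚ
combo [] i j = 0ℚ
combo ((l , W) ∷ ts) i j = l * charVec W i j + combo ts i j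

weightSum : ∀ {n} → List (ℚ × WeakOrder n) → ℚ
weightSum [] = 0ℚ
weightSum ((l , _) ∷ ts) = l + weightSum ts

InPWO : (n : ℕ) → Point n → Set
InPWO n x = Σ (List (ℚ × WeakOrder n)) λ ts →
    All (λ t → 0ℚ ≤ proj₁ t) ts
  × weightSum ts ≡ 1ℚ
  × (∀ i j → ¬ (i ≡ j) → x i j ≡ combo ts i j)

ValidForPWO : (n : ℕ) → (Point n → ℚ) → ℚ → Set
ValidForPWO n lhs π₀ = ∀ x → InPWO n x → lhs x ≤ π₀

sumFin : ∀ n → (Fin n → ℚ) → ℚ
sumFin ℕ.zero f = 0ℚ
sumFin (ℕ.suc n) f = f zero + sumFin n (λ i → f (suc i))

inNc : ∀ {n} → Fin n → Fin n → Fin n → Bool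
inNc i₁ i₂ j = not ⌊ j ≟ i₁ ⌋ ∧ not ⌊ j ≟ i₂ ⌋

lhs3 : ∀ n → Fin n → Fin n → Point n → ℚ
lhs3 n i₁ i₂ x =
  x i₂ i₁
  + sumFin n (λ j → if inNc i₁ i₂ j then x i₁ j + x j i₂ else 0ℚ)
  - x i₁ i₂
  - sumFin n (λ j → sumFin n (λ j′ →
      if inNc i₁ i₂ j ∧ inNc i₁ i₂ j′ ∧ not ⌊ j ≟ j′ ⌋ then x j j′ else 0ℚ))

rhs3 : ℕ → ℚ
rhs3 n = (+ 2 / 1) - ((+ n -ℤ + 4) *ℤ (+ n -ℤ + 5)) / 2

-- The left-hand side is linear and ignores the diagonal, so it suffices to bound it at
-- the characteristic vectors x^W. Write m = |N̂ᶜ| = n − 2, S = Σ_j (x_{i₁j} + x_{ji₂}) and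
-- D = Σ_{j≠j′} x_{jj′}; the right-hand side is 2m − m(m−1)/2 − 1. At a weak order S ≤ 2m
-- and, by totality, 2D ≥ m(m−1), which is already the bound when i₁ strictly precedes i₂.
-- When i₂ strictly precedes i₁, transitivity forbids x_{i₁j} = x_{ji₂} = 1, so S ≤ m and
-- m ≥ 2 pays for the term x_{i₂i₁}. When i₁ and i₂ are tied, either some j of N̂ᶜ is not
-- between them, costing 1 in S, or all of N̂ᶜ is tied with them, and then two of its
-- elements are tied with each other, adding 2 to 2D.

module Submission where

open import Defs
open import Data.Bool using (Bool; true; false; if_then_else_; not; _∧_)
open import Data.Empty using (⊥; ⊥-elim)
open import Data.Fin using (Fin; zero; suc; _≟_; punchIn; punchOut)
open import Data.Fin.Properties using (punchIn-injective; punchInᵢ≢i; punchIn-punchOut)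
open import Data.Integer as ℤ using (ℤ; +_)
open import Data.Integer.Tactic.RingSolver using (solve-∀)
open import Data.List using ([]; _∷_)
open import Data.List.Relation.Unary.All using (All; []; _∷_)
open import Data.Nat using (ℕ; _≥_; s≤s)
open import Data.Product using (Σ-syntax; _×_; _,_; proj₁)
open import Data.Rational using (ℚ; 0ℚ; 1ℚ; ½; _+_; _-_; _*_; -_; _≤_; _/_; fromℚᵘ; nonNegative)
open import Data.Rational.Properties hiding (_≟_)
open import Data.Rational.Solver using (module +-*-Solver)
open import Data.Rational.Unnormalised using (mkℚᵘ; *≡*)
import Data.Rational.Unnormalised as ℚᵘ
import Data.Rational.Unnormalised.Properties as ℚᵘ
open import Data.Sum using (_⊎_; inj₁; inj₂)
open import Data.Unit using (tt)
open import Function using (_∘_)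
open import Relation.Nullary using (¬_; yes; no)
open import Relation.Nullary.Decidable using (⌊_⌋; ⌊⌋-map′)
open import Relation.Binary.PropositionalEquality

-- Integers inside ℚ

fromℚᵘ-homo-+ : ∀ p q → fromℚᵘ (p ℚᵘ.+ q) ≡ fromℚᵘ p + fromℚᵘ q
fromℚᵘ-homo-+ p q = toℚᵘ-injective (ℚᵘ.≃-trans (toℚᵘ-fromℚᵘ (p ℚᵘ.+ q))
  (ℚᵘ.≃-sym (ℚᵘ.≃-trans (toℚᵘ-homo-+ (fromℚᵘ p) (fromℚᵘ q))
                        (ℚᵘ.+-cong (toℚᵘ-fromℚᵘ p) (toℚᵘ-fromℚᵘ q)))))

fromℚᵘ-homo-* : ∀ p q → fromℚᵘ (p ℚᵘ.* q) ≡ fromℚᵘ p * fromℚᵘ q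
fromℚᵘ-homo-* p q = toℚᵘ-injective (ℚᵘ.≃-trans (toℚᵘ-fromℚᵘ (p ℚᵘ.* q))
  (ℚᵘ.≃-sym (ℚᵘ.≃-trans (toℚᵘ-homo-* (fromℚᵘ p) (fromℚᵘ q))
                        (ℚᵘ.*-cong (toℚᵘ-fromℚᵘ p) (toℚᵘ-fromℚᵘ q)))))

fromℚᵘ-homo‿- : ∀ p → fromℚᵘ (ℚᵘ.- p) ≡ - fromℚᵘ p
fromℚᵘ-homo‿- p = toℚᵘ-injective (ℚᵘ.≃-trans (toℚᵘ-fromℚᵘ (ℚᵘ.- p))
  (ℚᵘ.≃-sym (ℚᵘ.≃-trans (toℚᵘ-homo‿- (fromℚᵘ p)) (ℚᵘ.-‿cong (toℚᵘ-fromℚᵘ p)))))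

ι : ℤ → ℚ
ι z = z / 1

ι-+ : ∀ a b → ι (a ℤ.+ b) ≡ ι a + ι b
ι-+ a b = trans (fromℚᵘ-cong {mkℚᵘ (a ℤ.+ b) 0} {mkℚᵘ a 0 ℚᵘ.+ mkℚᵘ b 0} (*≡* (eq a b)))
                (fromℚᵘ-homo-+ (mkℚᵘ a 0) (mkℚᵘ b 0))
  where
  eq : ∀ a b → (a ℤ.+ b) ℤ.* + 1 ≡ (a ℤ.* + 1 ℤ.+ b ℤ.* + 1) ℤ.* + 1
  eq = solve-∀

ι-* : ∀ a b → ι (a ℤ.* b) ≡ ι a * ι b
ι-* a b = fromℚᵘ-homo-* (mkℚᵘ a 0) (mkℚᵘ b 0)

ι-- : ∀ a b → ι (a ℤ.- b) ≡ ι a - ι b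
ι-- a b = trans (ι-+ a (ℤ.- b)) (cong (_+_ (ι a)) (fromℚᵘ-homo‿- (mkℚᵘ b 0)))

/2≡ι*½ : ∀ z → z / 2 ≡ ι z * ½
/2≡ι*½ z = trans (fromℚᵘ-cong {mkℚᵘ z 1} {mkℚᵘ z 0 ℚᵘ.* mkℚᵘ (+ 1) 1} (*≡* (eq z)))
                 (fromℚᵘ-homo-* (mkℚᵘ z 0) (mkℚᵘ (+ 1) 1))
  where
  eq : ∀ z → z ℤ.* + 2 ≡ (z ℤ.* + 1) ℤ.* + 2
  eq = solve-∀

-- Finite sums

sumFin-cong : ∀ n {f g : Fin n → ℚ} → (∀ j → f j ≡ g j) → sumFin n f ≡ sumFin n g
sumFin-cong ℕ.zero    f≡g = refl
sumFin-cong (ℕ.suc n) f≡g = cong₂ _+_ (f≡g zero) (sumFin-cong n (f≡g ∘ suc))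

sumFin-zero : ∀ n → sumFin n (λ _ → 0ℚ) ≡ 0ℚ
sumFin-zero ℕ.zero    = refl
sumFin-zero (ℕ.suc n) = cong (_+_ 0ℚ) (sumFin-zero n)

sumFin-+ : ∀ n (f g : Fin n → ℚ) → sumFin n (λ j → f j + g j) ≡ sumFin n f + sumFin n g
sumFin-+ ℕ.zero    f g = sym (+-identityʳ 0ℚ)
sumFin-+ (ℕ.suc n) f g =
  trans (cong (_+_ (f zero + g zero)) (sumFin-+ n (f ∘ suc) (g ∘ suc)))
        (medial (f zero) (g zero) (sumFin n (f ∘ suc)) (sumFin n (g ∘ suc)))
  where
  open +-*-Solver
  medial : ∀ a b c d → (a + b) + (c + d) ≡ (a + c) + (b + d)
  medial = solve 4 (λ a b c d → (a :+ b) :+ (c :+ d) := (a :+ c) :+ (b :+ d)) refl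

sumFin-*ˡ : ∀ n l (f : Fin n → ℚ) → sumFin n (λ j → l * f j) ≡ l * sumFin n f
sumFin-*ˡ ℕ.zero    l f = sym (*-zeroʳ l)
sumFin-*ˡ (ℕ.suc n) l f =
  trans (cong (_+_ (l * f zero)) (sumFin-*ˡ n l (f ∘ suc))) (sym (*-distribˡ-+ l _ _))

sumFin-*ʳ : ∀ n l (f : Fin n → ℚ) → sumFin n (λ j → f j * l) ≡ sumFin n f * l
sumFin-*ʳ n l f = trans (sumFin-cong n (λ j → *-comm (f j) l)) (trans (sumFin-*ˡ n l f) (*-comm l _))

sumFin-linear : ∀ n l (f g : Fin n → ℚ) →
  sumFin n (λ j → l * f j + g j) ≡ l * sumFin n f + sumFin n g
sumFin-linear n l f g = trans (sumFin-+ n _ g) (cong (_+ sumFin n g) (sumFin-*ˡ n l f))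

sumFin-swap : ∀ m n (f : Fin m → Fin n → ℚ) →
  sumFin m (λ i → sumFin n (f i)) ≡ sumFin n (λ j → sumFin m (λ i → f i j))
sumFin-swap ℕ.zero    n f = sym (sumFin-zero n)
sumFin-swap (ℕ.suc m) n f =
  trans (cong (_+_ (sumFin n (f zero))) (sumFin-swap m n (f ∘ suc)))
        (sym (sumFin-+ n (f zero) (λ j → sumFin m (λ i → f (suc i) j))))

sumFin-mono : ∀ n {f g : Fin n → ℚ} → (∀ j → f j ≤ g j) → sumFin n f ≤ sumFin n g
sumFin-mono ℕ.zero    f≤g = ≤-refl
sumFin-mono (ℕ.suc n) f≤g = +-mono-≤ (f≤g zero) (sumFin-mono n (f≤g ∘ suc))

sumFin-mono-+at : ∀ n {f g : Fin n → ℚ} (p : Fin n) d → (∀ j → f j ≤ g j) →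
  f p + d ≤ g p → sumFin n f + d ≤ sumFin n g
sumFin-mono-+at (ℕ.suc n) {f} zero d f≤g fp+d≤gp =
  ≤-trans (≤-reflexive (swap (f zero) _ d)) (+-mono-≤ fp+d≤gp (sumFin-mono n (f≤g ∘ suc)))
  where
  open +-*-Solver
  swap : ∀ a b d → (a + b) + d ≡ (a + d) + b
  swap = solve 3 (λ a b d → (a :+ b) :+ d := (a :+ d) :+ b) refl
sumFin-mono-+at (ℕ.suc n) {f} (suc p) d f≤g fp+d≤gp =
  ≤-trans (≤-reflexive (+-assoc (f zero) _ d))
          (+-mono-≤ (f≤g zero) (sumFin-mono-+at n p d (f≤g ∘ suc) fp+d≤gp))

sumFin-mono-+at₂ : ∀ n {f g : Fin n → ℚ} (p q : Fin n) d e → ¬ p ≡ q → (∀ j → f j ≤ g j) →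
  f p + d ≤ g p → f q + e ≤ g q → sumFin n f + d + e ≤ sumFin n g
sumFin-mono-+at₂ (ℕ.suc n) zero zero d e p≢q _ _ _ = ⊥-elim (p≢q refl)
sumFin-mono-+at₂ (ℕ.suc n) {f} zero (suc q) d e _ f≤g fp+d≤gp fq+e≤gq =
  ≤-trans (≤-reflexive (regroup (f zero) _ d e))
          (+-mono-≤ fp+d≤gp (sumFin-mono-+at n q e (f≤g ∘ suc) fq+e≤gq))
  where
  open +-*-Solver
  regroup : ∀ a b d e → (a + b) + d + e ≡ (a + d) + (b + e)
  regroup = solve 4 (λ a b d e → (a :+ b) :+ d :+ e := (a :+ d) :+ (b :+ e)) refl
sumFin-mono-+at₂ (ℕ.suc n) {f} (suc p) zero d e _ f≤g fp+d≤gp fq+e≤gq =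
  ≤-trans (≤-reflexive (regroup (f zero) _ d e))
          (+-mono-≤ fq+e≤gq (sumFin-mono-+at n p d (f≤g ∘ suc) fp+d≤gp))
  where
  open +-*-Solver
  regroup : ∀ a b d e → (a + b) + d + e ≡ (a + e) + (b + d)
  regroup = solve 4 (λ a b d e → (a :+ b) :+ d :+ e := (a :+ e) :+ (b :+ d)) refl
sumFin-mono-+at₂ (ℕ.suc n) {f} (suc p) (suc q) d e p≢q f≤g fp+d≤gp fq+e≤gq =
  ≤-trans (≤-reflexive (regroup (f zero) _ d e))
          (+-mono-≤ (f≤g zero)
            (sumFin-mono-+at₂ n p q d e (p≢q ∘ cong suc) (f≤g ∘ suc) fp+d≤gp fq+e≤gq))
  where
  open +-*-Solver
  regroup : ∀ a b d e → (a + b) + d + e ≡ a + (b + d + e)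
  regroup = solve 4 (λ a b d e → (a :+ b) :+ d :+ e := a :+ (b :+ d :+ e)) refl

false≢true : false ≡ true → ⊥
false≢true ()

χ : Bool → ℚ
χ b = if b then 1ℚ else 0ℚ

χ-nonneg : ∀ b → 0ℚ ≤ χ b
χ-nonneg true  = ≤ᵇ⇒≤ tt
χ-nonneg false = ≤-refl

sumFin-δˡ : ∀ n (a : Fin n) → sumFin n (λ j → χ ⌊ a ≟ j ⌋) ≡ 1ℚ
sumFin-δˡ (ℕ.suc n) zero    = cong (_+_ 1ℚ) (sumFin-zero n)
sumFin-δˡ (ℕ.suc n) (suc a) = cong (_+_ 0ℚ) (trans
  (sumFin-cong n (λ j → cong χ (⌊⌋-map′ (cong suc) _ (a ≟ j)))) (sumFin-δˡ n a))

sumFin-δʳ : ∀ n (a : Fin n) → sumFin n (λ j → χ ⌊ j ≟ a ⌋) ≡ 1ℚ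
sumFin-δʳ (ℕ.suc n) zero    = cong (_+_ 1ℚ) (sumFin-zero n)
sumFin-δʳ (ℕ.suc n) (suc a) = cong (_+_ 0ℚ) (trans
  (sumFin-cong n (λ j → cong χ (⌊⌋-map′ (cong suc) _ (j ≟ a)))) (sumFin-δʳ n a))

sumFin-ι : ∀ n → sumFin n (λ _ → 1ℚ) ≡ ι (+ n)
sumFin-ι ℕ.zero    = refl
sumFin-ι (ℕ.suc n) = trans (cong (_+_ 1ℚ) (sumFin-ι n)) (sym (ι-+ (+ 1) (+ n)))

-- Convex combinations

IgnoresDiagonal : ∀ {n} → (Point n → ℚ) → Set
IgnoresDiagonal {n} f = ∀ x y → (∀ i j → ¬ i ≡ j → x i j ≡ y i j) → f x ≡ f y

Linear : ∀ {n} → (Point n → ℚ) → Set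
Linear {n} f = ∀ l (x y : Point n) → f (λ i j → l * x i j + y i j) ≡ l * f x + f y

valid-if-bounded-on-vertices : ∀ {n} (f : Point n → ℚ) {r} → IgnoresDiagonal f →
  f (λ _ _ → 0ℚ) ≡ 0ℚ → Linear f → (∀ W → f (charVec W) ≤ r) → ValidForPWO n f r
valid-if-bounded-on-vertices f {r} ignores f0≡0 linear bounded x (ts , ts≥0 , Σts≡1 , x≡ts) =
  begin
    f x                      ≡⟨ ignores x (combo ts) x≡ts ⟩
    f (combo ts)             ≤⟨ combo-bound ts ts≥0 ⟩
    weightSum ts * r         ≡⟨ cong (_* r) Σts≡1 ⟩
    1ℚ * r                   ≡⟨ *-identityˡ r ⟩
    r                        ∎
  where
  open ≤-Reasoning
  combo-bound : ∀ ts → All (λ t → 0ℚ ≤ proj₁ t) ts → f (combo ts) ≤ weightSum ts * r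
  combo-bound [] [] = ≤-reflexive (trans f0≡0 (sym (*-zeroˡ r)))
  combo-bound ((l , W) ∷ ts) (l≥0 ∷ ts≥0) = begin
    f (combo ((l , W) ∷ ts))            ≡⟨ linear l (charVec W) (combo ts) ⟩
    l * f (charVec W) + f (combo ts)    ≤⟨ +-mono-≤ (*-monoˡ-≤-nonNeg l {{nonNegative l≥0}} (bounded W))
                                                    (combo-bound ts ts≥0) ⟩
    l * r + weightSum ts * r            ≡⟨ *-distribʳ-+ r l (weightSum ts) ⟨
    weightSum ((l , W) ∷ ts) * r        ∎

-- Linearity of the left-hand side

if-linear : ∀ c l (u v : ℚ) →
  (if c then l * u + v else 0ℚ) ≡ l * (if c then u else 0ℚ) + (if c then v else 0ℚ)
if-linear true  l u v = refl
if-linear false l u v = sym (trans (+-identityʳ _) (*-zeroʳ l))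

if-cong : ∀ c {u v : ℚ} → (c ≡ true → u ≡ v) → (if c then u else 0ℚ) ≡ (if c then v else 0ℚ)
if-cong true  u≡v = u≡v refl
if-cong false u≡v = refl

if-zero : ∀ c → (if c then 0ℚ else 0ℚ) ≡ 0ℚ
if-zero true  = refl
if-zero false = refl

if-+ : ∀ c (u v : ℚ) → (if c then u + v else 0ℚ) ≡ (if c then u else 0ℚ) + (if c then v else 0ℚ)
if-+ true  u v = refl
if-+ false u v = sym (+-identityʳ 0ℚ)

sumFin-if-linear : ∀ n (c : Fin n → Bool) l (u v : Fin n → ℚ) →
  sumFin n (λ j → if c j then l * u j + v j else 0ℚ)
  ≡ l * sumFin n (λ j → if c j then u j else 0ℚ) + sumFin n (λ j → if c j then v j else 0ℚ)
sumFin-if-linear n c l u v =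
  trans (sumFin-cong n (λ j → if-linear (c j) l (u j) (v j))) (sumFin-linear n l _ _)

≟-true : ∀ {n} {i j : Fin n} → ⌊ i ≟ j ⌋ ≡ true → i ≡ j
≟-true {i = i} {j} eq with i ≟ j
... | yes i≡j = i≡j

inNc-intro : ∀ {n} {i₁ i₂ j : Fin n} → ¬ j ≡ i₁ → ¬ j ≡ i₂ → inNc i₁ i₂ j ≡ true
inNc-intro {i₁ = i₁} {i₂} {j} j≢i₁ j≢i₂ with j ≟ i₁ | j ≟ i₂
... | yes j≡i₁ | _        = ⊥-elim (j≢i₁ j≡i₁)
... | no _     | yes j≡i₂ = ⊥-elim (j≢i₂ j≡i₂)
... | no _     | no _     = refl

inNc-elim : ∀ {n} {i₁ i₂ j : Fin n} → inNc i₁ i₂ j ≡ true → ¬ j ≡ i₁ × ¬ j ≡ i₂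
inNc-elim {i₁ = i₁} {i₂} {j} eq with j ≟ i₁ | j ≟ i₂
... | no j≢i₁ | no j≢i₂ = j≢i₁ , j≢i₂

module _ {n : ℕ} (i₁ i₂ : Fin n) where

  pathSum : Point n → ℚ
  pathSum x = sumFin n (λ j → if inNc i₁ i₂ j then x i₁ j + x j i₂ else 0ℚ)

  inPair : Fin n → Fin n → Bool
  inPair j j′ = inNc i₁ i₂ j ∧ inNc i₁ i₂ j′ ∧ not ⌊ j ≟ j′ ⌋

  pairSum : Point n → ℚ
  pairSum x = sumFin n (λ j → sumFin n (λ j′ → if inPair j j′ then x j j′ else 0ℚ))

  inPair-elim : ∀ {j j′} → inPair j j′ ≡ true → ¬ j ≡ j′
  inPair-elim {j} {j′} eq j≡j′ with inNc i₁ i₂ j | inNc i₁ i₂ j′ | j ≟ j′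
  inPair-elim eq j≡j′ | true | true | no j≢j′ = j≢j′ j≡j′

  inPair-intro : ∀ {j j′} → inNc i₁ i₂ j ≡ true → inNc i₁ i₂ j′ ≡ true → ¬ j ≡ j′ → inPair j j′ ≡ true
  inPair-intro {j} {j′} j∈ j′∈ j≢j′ rewrite j∈ | j′∈ with j ≟ j′
  ... | yes j≡j′ = ⊥-elim (j≢j′ j≡j′)
  ... | no _     = refl

  inPair-sym : ∀ j j′ → inPair j j′ ≡ inPair j′ j
  inPair-sym j j′ with inNc i₁ i₂ j | inNc i₁ i₂ j′ | j ≟ j′ | j′ ≟ j
  ... | true  | true  | yes _   | yes _    = refl
  ... | true  | true  | no _    | no _     = refl
  ... | true  | true  | yes j≡j′ | no j′≢j = ⊥-elim (j′≢j (sym j≡j′))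
  ... | true  | true  | no j≢j′ | yes j′≡j = ⊥-elim (j≢j′ (sym j′≡j))
  ... | true  | false | _       | _        = refl
  ... | false | true  | _       | _        = refl
  ... | false | false | _       | _        = refl

  pairSum-symmetrised : ∀ x → pairSum x + pairSum x
    ≡ sumFin n (λ j → sumFin n (λ j′ → if inPair j j′ then x j j′ + x j′ j else 0ℚ))
  pairSum-symmetrised x = sym (begin
    sumFin n (λ j → sumFin n (λ j′ → if inPair j j′ then x j j′ + x j′ j else 0ℚ))
      ≡⟨ sumFin-cong n (λ j → trans (sumFin-cong n (λ j′ → if-+ (inPair j j′) _ _)) (sumFin-+ n _ _)) ⟩
    sumFin n (λ j → pairRow j + transposedRow j)
      ≡⟨ sumFin-+ n pairRow transposedRow ⟩
    pairSum x + sumFin n transposedRow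
      ≡⟨ cong (_+_ (pairSum x)) transposed≡pairSum ⟩
    pairSum x + pairSum x ∎)
    where
    open ≡-Reasoning
    pairRow transposedRow : Fin n → ℚ
    pairRow j = sumFin n (λ j′ → if inPair j j′ then x j j′ else 0ℚ)
    transposedRow j = sumFin n (λ j′ → if inPair j j′ then x j′ j else 0ℚ)
    transposed≡pairSum : sumFin n transposedRow ≡ pairSum x
    transposed≡pairSum = trans (sumFin-swap n n (λ j j′ → if inPair j j′ then x j′ j else 0ℚ))
      (sumFin-cong n (λ j′ → sumFin-cong n (λ j →
        cong (λ c → if c then x j′ j else 0ℚ) (inPair-sym j j′))))

  pathSum-linear : Linear pathSum
  pathSum-linear l x y = trans
    (sumFin-cong n (λ j → cong (λ t → if inNc i₁ i₂ j then t else 0ℚ) (regroup l _ _ _ _)))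
    (sumFin-if-linear n (inNc i₁ i₂) l _ _)
    where
    open +-*-Solver
    regroup : ∀ l a b c d → (l * a + b) + (l * c + d) ≡ l * (a + c) + (b + d)
    regroup = solve 5 (λ l a b c d → (l :* a :+ b) :+ (l :* c :+ d) := l :* (a :+ c) :+ (b :+ d)) refl

  pairSum-linear : Linear pairSum
  pairSum-linear l x y = trans
    (sumFin-cong n (λ j → sumFin-if-linear n (inPair j) l (x j) (y j)))
    (sumFin-linear n l _ _)

  lhs3-linear : Linear (lhs3 n i₁ i₂)
  lhs3-linear l x y = trans
    (cong₂ (λ s d → (l * x i₂ i₁ + y i₂ i₁) + s - (l * x i₁ i₂ + y i₁ i₂) - d)
           (pathSum-linear l x y) (pairSum-linear l x y))
    (regroup l (x i₂ i₁) (pathSum x) (x i₁ i₂) (pairSum x) (y i₂ i₁) (pathSum y) (y i₁ i₂) (pairSum y))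
    where
    open +-*-Solver
    regroup : ∀ l a s b d a′ s′ b′ d′ →
      (l * a + a′) + (l * s + s′) - (l * b + b′) - (l * d + d′) ≡ l * (a + s - b - d) + (a′ + s′ - b′ - d′)
    regroup = solve 9 (λ l a s b d a′ s′ b′ d′ →
      (l :* a :+ a′) :+ (l :* s :+ s′) :- (l :* b :+ b′) :- (l :* d :+ d′)
      := l :* (a :+ s :- b :- d) :+ (a′ :+ s′ :- b′ :- d′)) refl

  lhs3-zero : lhs3 n i₁ i₂ (λ _ _ → 0ℚ) ≡ 0ℚ
  lhs3-zero = cong₂ (λ s d → 0ℚ + s - 0ℚ - d)
    (trans (sumFin-cong n (λ j → if-zero (inNc i₁ i₂ j))) (sumFin-zero n))
    (trans (sumFin-cong n (λ j → trans (sumFin-cong n (λ j′ → if-zero (inPair j j′))) (sumFin-zero n)))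
           (sumFin-zero n))

  lhs3-ignoresDiagonal : ¬ i₁ ≡ i₂ → IgnoresDiagonal (lhs3 n i₁ i₂)
  lhs3-ignoresDiagonal i₁≢i₂ x y x≡y = cong₂ _-_
    (cong₂ _-_ (cong₂ _+_ (x≡y i₂ i₁ (i₁≢i₂ ∘ sym)) pathSum≡) (x≡y i₁ i₂ i₁≢i₂))
    pairSum≡
    where
    pathSum≡ : pathSum x ≡ pathSum y
    pathSum≡ = sumFin-cong n (λ j → if-cong (inNc i₁ i₂ j) (λ j∈ →
      let j≢i₁ , j≢i₂ = inNc-elim j∈ in cong₂ _+_ (x≡y i₁ j (j≢i₁ ∘ sym)) (x≡y j i₂ j≢i₂)))
    pairSum≡ : pairSum x ≡ pairSum y
    pairSum≡ = sumFin-cong n (λ j → sumFin-cong n (λ j′ →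
      if-cong (inPair j j′) (λ jj′∈ → x≡y j j′ (inPair-elim jj′∈))))

-- Counting in N̂ᶜ

χ-∧-not : ∀ b c → (c ≡ true → b ≡ true) → χ (b ∧ not c) + χ c ≡ χ b
χ-∧-not true  false _   = refl
χ-∧-not false false _   = refl
χ-∧-not true  true  _   = refl
χ-∧-not false true  c⇒b with c⇒b refl
... | ()

module _ {n : ℕ} (i₁ i₂ : Fin n) where

  cardNc : ℚ
  cardNc = sumFin n (λ j → χ (inNc i₁ i₂ j))

  card≡cardNc+2 : ¬ i₁ ≡ i₂ → sumFin n (λ _ → 1ℚ) ≡ cardNc + 1ℚ + 1ℚ
  card≡cardNc+2 i₁≢i₂ = begin
    sumFin n (λ _ → 1ℚ)
      ≡⟨ sumFin-cong n partition ⟨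
    sumFin n (λ j → χ (inNc i₁ i₂ j) + χ ⌊ j ≟ i₁ ⌋ + χ ⌊ j ≟ i₂ ⌋)
      ≡⟨ sumFin-+ n _ _ ⟩
    sumFin n (λ j → χ (inNc i₁ i₂ j) + χ ⌊ j ≟ i₁ ⌋) + sumFin n (λ j → χ ⌊ j ≟ i₂ ⌋)
      ≡⟨ cong₂ _+_ (sumFin-+ n _ _) (sumFin-δʳ n i₂) ⟩
    cardNc + sumFin n (λ j → χ ⌊ j ≟ i₁ ⌋) + 1ℚ
      ≡⟨ cong (λ c → cardNc + c + 1ℚ) (sumFin-δʳ n i₁) ⟩
    cardNc + 1ℚ + 1ℚ ∎
    where
    open ≡-Reasoning
    partition : ∀ j → χ (inNc i₁ i₂ j) + χ ⌊ j ≟ i₁ ⌋ + χ ⌊ j ≟ i₂ ⌋ ≡ 1ℚ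
    partition j with j ≟ i₁ | j ≟ i₂
    ... | yes j≡i₁ | yes j≡i₂ = ⊥-elim (i₁≢i₂ (trans (sym j≡i₁) j≡i₂))
    ... | yes _    | no _     = refl
    ... | no _     | yes _    = refl
    ... | no _     | no _     = refl

  pairRowCount : ∀ j → sumFin n (λ j′ → χ (inPair i₁ i₂ j j′)) ≡ χ (inNc i₁ i₂ j) * (cardNc - 1ℚ)
  pairRowCount j with inNc i₁ i₂ j in j∈
  ... | false = trans (sumFin-zero n) (sym (*-zeroˡ (cardNc - 1ℚ)))
  ... | true  = begin
    row                          ≡⟨ solve 1 (λ r → r := con 1ℚ :* ((r :+ con 1ℚ) :- con 1ℚ)) refl row ⟩
    1ℚ * ((row + 1ℚ) - 1ℚ)       ≡⟨ cong (λ c → 1ℚ * (c - 1ℚ)) row+1≡cardNc ⟩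
    1ℚ * (cardNc - 1ℚ)           ∎
    where
    open ≡-Reasoning
    open +-*-Solver
    row : ℚ
    row = sumFin n (λ j′ → χ (inNc i₁ i₂ j′ ∧ not ⌊ j ≟ j′ ⌋))
    row+1≡cardNc : row + 1ℚ ≡ cardNc
    row+1≡cardNc = begin
      row + 1ℚ
        ≡⟨ cong (_+_ row) (sumFin-δˡ n j) ⟨
      row + sumFin n (λ j′ → χ ⌊ j ≟ j′ ⌋)
        ≡⟨ sumFin-+ n _ _ ⟨
      sumFin n (λ j′ → χ (inNc i₁ i₂ j′ ∧ not ⌊ j ≟ j′ ⌋) + χ ⌊ j ≟ j′ ⌋)
        ≡⟨ sumFin-cong n (λ j′ → χ-∧-not (inNc i₁ i₂ j′) ⌊ j ≟ j′ ⌋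
                                   (λ j≡j′ → subst (λ k → inNc i₁ i₂ k ≡ true) (≟-true j≡j′) j∈)) ⟩
      cardNc ∎

  pairCount : sumFin n (λ j → sumFin n (λ j′ → χ (inPair i₁ i₂ j j′))) ≡ cardNc * (cardNc - 1ℚ)
  pairCount = trans (sumFin-cong n pairRowCount) (sumFin-*ʳ n (cardNc - 1ℚ) (χ ∘ inNc i₁ i₂))

outside-pair : ∀ {n} → n ≥ 4 → {i₁ i₂ : Fin n} → ¬ i₁ ≡ i₂ →
  Σ[ p ∈ Fin n ] Σ[ q ∈ Fin n ] ¬ p ≡ q × inNc i₁ i₂ p ≡ true × inNc i₁ i₂ q ≡ true
outside-pair {ℕ.suc (ℕ.suc (ℕ.suc (ℕ.suc k)))} (s≤s (s≤s (s≤s (s≤s _)))) {i₁} {i₂} i₁≢i₂ =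
  skip zero , skip (suc zero) , (λ ()) ∘ skip-injective , skip-outside zero , skip-outside (suc zero)
  where
  i₂′ : Fin (ℕ.suc (ℕ.suc (ℕ.suc k)))
  i₂′ = punchOut i₁≢i₂
  skip : Fin (ℕ.suc (ℕ.suc k)) → Fin (ℕ.suc (ℕ.suc (ℕ.suc (ℕ.suc k))))
  skip = punchIn i₁ ∘ punchIn i₂′
  skip-injective : ∀ {j k} → skip j ≡ skip k → j ≡ k
  skip-injective {j} {k} = punchIn-injective i₂′ j k ∘ punchIn-injective i₁ _ _
  skip-outside : ∀ j → inNc i₁ i₂ (skip j) ≡ true
  skip-outside j = inNc-intro (punchInᵢ≢i i₁ _) (λ skipj≡i₂ → punchInᵢ≢i i₂′ j
    (punchIn-injective i₁ _ _ (trans skipj≡i₂ (sym (punchIn-punchOut i₁≢i₂)))))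

two≤cardNc : ∀ {n} → n ≥ 4 → {i₁ i₂ : Fin n} → ¬ i₁ ≡ i₂ → 1ℚ + 1ℚ ≤ cardNc i₁ i₂
two≤cardNc {n} n≥4 i₁≢i₂ with outside-pair n≥4 i₁≢i₂
... | p , q , p≢q , p∈ , q∈ =
  ≤-trans (≤-reflexive (cong (λ z → z + 1ℚ + 1ℚ) (sym (sumFin-zero n))))
          (sumFin-mono-+at₂ n p q 1ℚ 1ℚ p≢q (λ _ → χ-nonneg _)
            (≤-reflexive (cong χ (sym p∈))) (≤-reflexive (cong χ (sym q∈))))

-- Weak orders

pathTerm≤2 : ∀ c b b′ → (if c then χ b + χ b′ else 0ℚ) ≤ χ c + χ c
pathTerm≤2 false _     _     = ≤-refl
pathTerm≤2 true  true  true  = ≤-refl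
pathTerm≤2 true  true  false = ≤ᵇ⇒≤ tt
pathTerm≤2 true  false true  = ≤ᵇ⇒≤ tt
pathTerm≤2 true  false false = ≤ᵇ⇒≤ tt

pathTerm≤1 : ∀ c b b′ → (b ≡ true → b′ ≡ true → ⊥) → (if c then χ b + χ b′ else 0ℚ) ≤ χ c
pathTerm≤1 false _     _     _    = ≤-refl
pathTerm≤1 true  true  true  ¬bb′ = ⊥-elim (¬bb′ refl refl)
pathTerm≤1 true  true  false _    = ≤-refl
pathTerm≤1 true  false true  _    = ≤-refl
pathTerm≤1 true  false false _    = ≤ᵇ⇒≤ tt

pathTerm+1≤2 : ∀ c b b′ → c ≡ true → b ≡ false ⊎ b′ ≡ false →
  (if c then χ b + χ b′ else 0ℚ) + 1ℚ ≤ χ c + χ c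
pathTerm+1≤2 true true  true  _ (inj₁ ())
pathTerm+1≤2 true true  true  _ (inj₂ ())
pathTerm+1≤2 true true  false _ _ = ≤-refl
pathTerm+1≤2 true false true  _ _ = ≤-refl
pathTerm+1≤2 true false false _ _ = ≤ᵇ⇒≤ tt

pairTerm≥1 : ∀ c b b′ → b ≡ true ⊎ b′ ≡ true → χ c ≤ (if c then χ b + χ b′ else 0ℚ)
pairTerm≥1 false _     _     _         = ≤-refl
pairTerm≥1 true  true  true  _         = ≤ᵇ⇒≤ tt
pairTerm≥1 true  true  false _         = ≤-refl
pairTerm≥1 true  false true  _         = ≤-refl
pairTerm≥1 true  false false (inj₁ ())
pairTerm≥1 true  false false (inj₂ ())

pairTerm≥2 : ∀ c b b′ → c ≡ true → b ≡ true → b′ ≡ true → χ c + 1ℚ ≤ (if c then χ b + χ b′ else 0ℚ)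
pairTerm≥2 true true true _ _ _ = ≤-refl

module _ {n : ℕ} {i₁ i₂ : Fin n} {W : Rel₂ n} (isWeakOrder : IsWeakOrder W) where

  open IsWeakOrder isWeakOrder using () renaming (trans to W-trans; total to W-total)

  private
    w : Point n
    w i j = χ (W i j)

    M : ℚ
    M = cardNc i₁ i₂

  pathSum≤ : pathSum i₁ i₂ w ≤ M + M
  pathSum≤ = ≤-trans (sumFin-mono n (λ j → pathTerm≤2 (inNc i₁ i₂ j) (W i₁ j) (W j i₂)))
                     (≤-reflexive (sumFin-+ n _ _))

  pathSum+1≤ : ∀ p → inNc i₁ i₂ p ≡ true → W i₁ p ≡ false ⊎ W p i₂ ≡ false → pathSum i₁ i₂ w + 1ℚ ≤ M + M
  pathSum+1≤ p p∈ off-path = ≤-trans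
    (sumFin-mono-+at n p 1ℚ (λ j → pathTerm≤2 (inNc i₁ i₂ j) (W i₁ j) (W j i₂))
                            (pathTerm+1≤2 (inNc i₁ i₂ p) (W i₁ p) (W p i₂) p∈ off-path))
    (≤-reflexive (sumFin-+ n _ _))

  pathSum≤-if-i₂≺i₁ : W i₁ i₂ ≡ false → pathSum i₁ i₂ w ≤ M
  pathSum≤-if-i₂≺i₁ W₁₂≡false = sumFin-mono n (λ j → pathTerm≤1 (inNc i₁ i₂ j) (W i₁ j) (W j i₂)
    (λ W₁ⱼ Wⱼ₂ → false≢true (trans (sym W₁₂≡false) (W-trans i₁ j i₂ W₁ⱼ Wⱼ₂))))

  private
    pairTerms : Fin n → Fin n → ℚ
    pairTerms j j′ = if inPair i₁ i₂ j j′ then w j j′ + w j′ j else 0ℚ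

    pairRow≥ : ∀ j → sumFin n (λ j′ → χ (inPair i₁ i₂ j j′)) ≤ sumFin n (pairTerms j)
    pairRow≥ j = sumFin-mono n (λ j′ → pairTerm≥1 (inPair i₁ i₂ j j′) (W j j′) (W j′ j) (W-total j j′))

  pairSum≥ : M * (M - 1ℚ) ≤ pairSum i₁ i₂ w + pairSum i₁ i₂ w
  pairSum≥ = begin
    M * (M - 1ℚ)                                                 ≡⟨ pairCount i₁ i₂ ⟨
    sumFin n (λ j → sumFin n (λ j′ → χ (inPair i₁ i₂ j j′)))     ≤⟨ sumFin-mono n pairRow≥ ⟩
    sumFin n (λ j → sumFin n (pairTerms j))                      ≡⟨ pairSum-symmetrised i₁ i₂ w ⟨
    pairSum i₁ i₂ w + pairSum i₁ i₂ w                            ∎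
    where open ≤-Reasoning

  pairSum≥-if-tied : ∀ p q → ¬ p ≡ q → inNc i₁ i₂ p ≡ true → inNc i₁ i₂ q ≡ true →
    W p q ≡ true → W q p ≡ true → M * (M - 1ℚ) + 1ℚ + 1ℚ ≤ pairSum i₁ i₂ w + pairSum i₁ i₂ w
  pairSum≥-if-tied p q p≢q p∈ q∈ Wpq Wqp = begin
    M * (M - 1ℚ) + 1ℚ + 1ℚ
      ≡⟨ cong (λ c → c + 1ℚ + 1ℚ) (pairCount i₁ i₂) ⟨
    sumFin n (λ j → sumFin n (λ j′ → χ (inPair i₁ i₂ j j′))) + 1ℚ + 1ℚ
      ≤⟨ sumFin-mono-+at₂ n p q 1ℚ 1ℚ p≢q pairRow≥ (tiedRow p q p≢q p∈ q∈ Wpq Wqp)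
                                                   (tiedRow q p (p≢q ∘ sym) q∈ p∈ Wqp Wpq) ⟩
    sumFin n (λ j → sumFin n (pairTerms j))
      ≡⟨ pairSum-symmetrised i₁ i₂ w ⟨
    pairSum i₁ i₂ w + pairSum i₁ i₂ w ∎
    where
    open ≤-Reasoning
    tiedRow : ∀ j k → ¬ j ≡ k → inNc i₁ i₂ j ≡ true → inNc i₁ i₂ k ≡ true → W j k ≡ true → W k j ≡ true →
      sumFin n (λ j′ → χ (inPair i₁ i₂ j j′)) + 1ℚ ≤ sumFin n (pairTerms j)
    tiedRow j k j≢k j∈ k∈ Wjk Wkj = sumFin-mono-+at n k 1ℚ
      (λ j′ → pairTerm≥1 (inPair i₁ i₂ j j′) (W j j′) (W j′ j) (W-total j j′))
      (pairTerm≥2 (inPair i₁ i₂ j k) (W j k) (W k j) (inPair-intro i₁ i₂ j∈ k∈ j≢k) Wjk Wkj)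

slack-bound : ∀ {S D M : ℚ} a b s t → S + s ≤ M + M → M * (M - 1ℚ) + t ≤ D + D → a + 1ℚ ≤ b + s + t * ½ →
  a + S - b - D ≤ M + M - M * (M - 1ℚ) * ½ - 1ℚ
slack-bound {S} {D} {M} a b s t S+s≤ M[M-1]+t≤ enough = begin
  a + S - b - D
    ≤⟨ +-mono-≤ (+-monoˡ-≤ (- b) (+-monoʳ-≤ a S≤)) (neg-antimono-≤ D≥) ⟩
  a + (M + M - s) - b - (M * (M - 1ℚ) + t) * ½
    ≡⟨ regroup a b s t M ⟩
  (a + 1ℚ) - (b + s + t * ½) + R
    ≤⟨ +-monoˡ-≤ R (≤-trans (+-monoˡ-≤ (- (b + s + t * ½)) enough)
                            (≤-reflexive (+-inverseʳ (b + s + t * ½)))) ⟩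
  0ℚ + R
    ≡⟨ +-identityˡ R ⟩
  R ∎
  where
  open ≤-Reasoning
  open +-*-Solver
  R : ℚ
  R = M + M - M * (M - 1ℚ) * ½ - 1ℚ
  S≤ : S ≤ M + M - s
  S≤ = ≤-trans (≤-reflexive (solve 2 (λ S s → S := S :+ s :- s) refl S s)) (+-monoˡ-≤ (- s) S+s≤)
  D≥ : (M * (M - 1ℚ) + t) * ½ ≤ D
  D≥ = ≤-trans (*-monoʳ-≤-nonNeg ½ M[M-1]+t≤) (≤-reflexive (solve 1 (λ D → (D :+ D) :* con ½ := D) refl D))
  regroup : ∀ a b s t M → a + (M + M - s) - b - (M * (M - 1ℚ) + t) * ½
    ≡ (a + 1ℚ) - (b + s + t * ½) + (M + M - M * (M - 1ℚ) * ½ - 1ℚ)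
  regroup = solve 5 (λ a b s t M →
    a :+ (M :+ M :- s) :- b :- (M :* (M :- con 1ℚ) :+ t) :* con ½
    := (a :+ con 1ℚ) :- (b :+ s :+ t :* con ½) :+ (M :+ M :- M :* (M :- con 1ℚ) :* con ½ :- con 1ℚ)) refl

rhs3-via-cardNc : ∀ {n} {i₁ i₂ : Fin n} → ¬ i₁ ≡ i₂ →
  rhs3 n ≡ cardNc i₁ i₂ + cardNc i₁ i₂ - cardNc i₁ i₂ * (cardNc i₁ i₂ - 1ℚ) * ½ - 1ℚ
rhs3-via-cardNc {n} {i₁} {i₂} i₁≢i₂ = begin
  rhs3 n
    ≡⟨ cong (_-_ (ι (+ 2))) (/2≡ι*½ ((+ n ℤ.- + 4) ℤ.* (+ n ℤ.- + 5))) ⟩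
  ι (+ 2) - ι ((+ n ℤ.- + 4) ℤ.* (+ n ℤ.- + 5)) * ½
    ≡⟨ cong (λ v → ι (+ 2) - v * ½) (trans (ι-* (+ n ℤ.- + 4) (+ n ℤ.- + 5))
                                          (cong₂ _*_ (ι-- (+ n) (+ 4)) (ι-- (+ n) (+ 5)))) ⟩
  ι (+ 2) - (ι (+ n) - ι (+ 4)) * (ι (+ n) - ι (+ 5)) * ½
    ≡⟨ cong (λ c → ι (+ 2) - (c - ι (+ 4)) * (c - ι (+ 5)) * ½)
            (trans (sym (sumFin-ι n)) (card≡cardNc+2 i₁ i₂ i₁≢i₂)) ⟩
  ι (+ 2) - (M + 1ℚ + 1ℚ - ι (+ 4)) * (M + 1ℚ + 1ℚ - ι (+ 5)) * ½
    ≡⟨ solve 1 (λ M → con (ι (+ 2)) :- (M :+ con 1ℚ :+ con 1ℚ :- con (ι (+ 4)))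
                                       :* (M :+ con 1ℚ :+ con 1ℚ :- con (ι (+ 5))) :* con ½
                      := M :+ M :- M :* (M :- con 1ℚ) :* con ½ :- con 1ℚ) refl M ⟩
  M + M - M * (M - 1ℚ) * ½ - 1ℚ ∎
  where
  open ≡-Reasoning
  open +-*-Solver
  M : ℚ
  M = cardNc i₁ i₂

lhs3-at-weakOrder : ∀ {n} → n ≥ 4 → {i₁ i₂ : Fin n} → ¬ i₁ ≡ i₂ → (W : WeakOrder n) →
  lhs3 n i₁ i₂ (charVec W) ≤ rhs3 n
lhs3-at-weakOrder n≥4 {i₁} {i₂} i₁≢i₂ (W , isWeakOrder) =
  ≤-trans (by-order (W i₁ i₂) (W i₂ i₁) refl refl) (≤-reflexive (sym (rhs3-via-cardNc i₁≢i₂)))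
  where
  open IsWeakOrder isWeakOrder using () renaming (trans to W-trans; total to W-total)
  w : Point _
  w i j = χ (W i j)
  M S D R : ℚ
  M = cardNc i₁ i₂
  S = pathSum i₁ i₂ w
  D = pairSum i₁ i₂ w
  R = M + M - M * (M - 1ℚ) * ½ - 1ℚ

  bound : ∀ a b s t → S + s ≤ M + M → M * (M - 1ℚ) + t ≤ D + D → a + 1ℚ ≤ b + s + t * ½ → a + S - b - D ≤ R
  bound = slack-bound {S} {D} {M}

  S≤ : S + 0ℚ ≤ M + M
  S≤ = ≤-trans (≤-reflexive (+-identityʳ S)) (pathSum≤ isWeakOrder)

  D≥ : M * (M - 1ℚ) + 0ℚ ≤ D + D
  D≥ = ≤-trans (≤-reflexive (+-identityʳ (M * (M - 1ℚ)))) (pairSum≥ isWeakOrder)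

  off-path : ∀ p → inNc i₁ i₂ p ≡ true → W i₁ p ≡ false ⊎ W p i₂ ≡ false → 1ℚ + S - 1ℚ - D ≤ R
  off-path p p∈ off = bound 1ℚ 1ℚ 1ℚ 0ℚ (pathSum+1≤ isWeakOrder p p∈ off) D≥ (≤ᵇ⇒≤ tt)

  tied : W i₁ i₂ ≡ true → W i₂ i₁ ≡ true → 1ℚ + S - 1ℚ - D ≤ R
  tied W₁₂ W₂₁ with outside-pair n≥4 i₁≢i₂
  ... | p , q , p≢q , p∈ , q∈ with W i₁ p in W₁ₚ | W p i₂ in Wₚ₂ | W i₁ q in W₁q | W q i₂ in Wq₂
  ... | false | _     | _     | _     = off-path p p∈ (inj₁ W₁ₚ)
  ... | true  | false | _     | _     = off-path p p∈ (inj₂ Wₚ₂)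
  ... | true  | true  | false | _     = off-path q q∈ (inj₁ W₁q)
  ... | true  | true  | true  | false = off-path q q∈ (inj₂ Wq₂)
  ... | true  | true  | true  | true  = bound 1ℚ 1ℚ 0ℚ (1ℚ + 1ℚ) S≤
    (≤-trans (≤-reflexive (sym (+-assoc (M * (M - 1ℚ)) 1ℚ 1ℚ)))
             (pairSum≥-if-tied isWeakOrder p q p≢q p∈ q∈ Wpq Wqp)) (≤ᵇ⇒≤ tt)
    where
    Wpq : W p q ≡ true
    Wpq = W-trans p i₂ q Wₚ₂ (W-trans i₂ i₁ q W₂₁ W₁q)
    Wqp : W q p ≡ true
    Wqp = W-trans q i₂ p Wq₂ (W-trans i₂ i₁ p W₂₁ W₁ₚ)

  by-order : ∀ b₁₂ b₂₁ → W i₁ i₂ ≡ b₁₂ → W i₂ i₁ ≡ b₂₁ → χ b₂₁ + S - χ b₁₂ - D ≤ R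
  by-order true  false _   _   = bound 0ℚ 1ℚ 0ℚ 0ℚ S≤ D≥ (≤ᵇ⇒≤ tt)
  by-order false true  W₁₂ _   = bound 1ℚ 0ℚ M 0ℚ (+-monoˡ-≤ M (pathSum≤-if-i₂≺i₁ isWeakOrder W₁₂)) D≥
    (≤-trans (two≤cardNc n≥4 i₁≢i₂)
             (≤-reflexive (solve 1 (λ M → M := con 0ℚ :+ M :+ con 0ℚ :* con ½) refl M)))
    where open +-*-Solver
  by-order true  true  W₁₂ W₂₁ = tied W₁₂ W₂₁
  by-order false false W₁₂ W₂₁ with W-total i₁ i₂
  ... | inj₁ W₁₂′ = ⊥-elim (false≢true (trans (sym W₁₂) W₁₂′))
  ... | inj₂ W₂₁′ = ⊥-elim (false≢true (trans (sym W₂₁) W₂₁′))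

theorem3 : (n : ℕ) → n ≥ 4 → (i₁ i₂ : Fin n) → ¬ (i₁ ≡ i₂) →
    ValidForPWO n (lhs3 n i₁ i₂) (rhs3 n)
theorem3 n n≥4 i₁ i₂ i₁≢i₂ = valid-if-bounded-on-vertices (lhs3 n i₁ i₂)
  (lhs3-ignoresDiagonal i₁ i₂ i₁≢i₂) (lhs3-zero i₁ i₂) (lhs3-linear i₁ i₂)
  (lhs3-at-weakOrder n≥4 i₁≢i₂)
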